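{- Let $m\ge 2$ be an integer and $p$ a prime. Let $a_1\le\dots\le a_t$ be an $m$-product sequence, and let $kp^j$ (with $\gcd(k,p)=1$ and $j\ge 1$) be the smallest multiple of $p$ that appears in it. If $\gcd(j,m)=1$, then some term of the sequence different from $kp^j$ is of the form $rp^s$ with $\gcd(r,p)=1$ and $m\nmid s$. Consequently $a_t\ge kp^j+p$.
   Context: $\mathbb{N}=\{0,1,2,\dots\}$. For an integer $m\ge 2$, an $m$-product sequence is a finite sequence of integers $a_1\le a_2\le\dots\le a_t$ such that $\prod_{i=1}^t a_i=R^m$ for some $R\in\mathbb{N}$ and no integer appears more than $m-1$ times in the sequence. -}

module Defs where

open import Data.Nat using (ℕ; _≤_; _<_; _^_; _≟_)
open import Data.List using (List; filter; length)
open import Data.Nat.ListAction using (product)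
open import Data.List.Relation.Unary.Linked using (Linked)
open import Data.Product using (∃; _×_)
open import Relation.Binary.PropositionalEquality using (_≡_)

Nondecreasing : List ℕ → Set
Nondecreasing = Linked _≤_

occ : ℕ → List ℕ → ℕ
occ x xs = length (filter (_≟ x) xs)

IsMProductSeq : ℕ → List ℕ → Set
IsMProductSeq m xs =
  Nondecreasing xs × (∃ λ R → product xs ≡ R ^ m) × (∀ x → occ x xs < m)

{-# OPTIONS --safe #-}
-- Compare p-adic valuations on both sides of  a₁ ⋯ a_t = R^m.  The right side has valuation
-- divisible by m.  If every term other than kp^j had valuation divisible by m, the left side
-- would have valuation c·j modulo m, where 0 < c < m is the multiplicity of kp^j; since j is
-- coprime to m this forces m ∣ c, which is absurd.  A term rp^s with m ∤ s has s ≥ 1, so it is a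
-- multiple of p larger than the least one, kp^j, and hence at least kp^j + p.
module Submission where

open import Defs
open import Data.Nat using (ℕ; _≤_; _<_; _+_; _*_; _^_)
open import Data.Nat.Divisibility using (_∣_)
open import Data.Nat.Coprimality using (Coprime)
open import Data.Nat.Primality using (Prime)
open import Data.List using (List; last)
open import Data.List.Membership.Propositional using (_∈_)
open import Data.Maybe using (just)
open import Data.Product using (∃; ∃₂; _×_)
open import Relation.Binary.PropositionalEquality using (_≡_; _≢_)
open import Relation.Nullary using (¬_)

open import Algebra.Properties.CommutativeSemigroup using (interchange; x∙yz≈y∙xz)
open import Data.Nat.Base
  using ( zero; suc; NonZero; NonTrivial; z<s; >-nonZero; ≢-nonZero; ≢-nonZero⁻¹
        ; nonTrivial⇒≢1; nonTrivial⇒n>1)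
open import Data.Nat.Properties
open import Data.Nat.Divisibility using (_∤_; divides; _∣?_; ∣-refl; _∣0; ∣m+n∣m⇒∣n; m∣m*n; >⇒∤)
open import Data.Nat.Coprimality as Coprimality using (coprime-divisor; ¬0-coprimeTo-2+)
open import Data.Nat.Induction using (<-rec)
open import Data.Nat.Primality
  using (euclidsLemma; prime⇒irreducible; prime⇒nonZero; prime⇒nonTrivial)
open import Data.List using ([]; _∷_; length)
open import Data.List.Properties using (filter-accept; filter-reject)
open import Data.List.Membership.Propositional using (_∉_)
open import Data.List.Membership.Propositional.Properties using (∈-filter⁺; ∈-length)
open import Data.List.Relation.Unary.Any using (here; there)
open import Data.List.Relation.Unary.Linked using ([-]; _∷_)
open import Data.Nat.ListAction using (product)
open import Data.Product using (_,_)
open import Data.Sum using (_⊎_; inj₁; inj₂; [_,_])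
open import Function using (_∘_)
open import Relation.Nullary using (yes; no; contradiction)
open import Relation.Binary.PropositionalEquality
  using (refl; sym; trans; cong; subst; module ≡-Reasoning)

open ≡-Reasoning

m*n^o*n≡m*n^[1+o] : ∀ m n o → m * n ^ o * n ≡ m * n ^ suc o
m*n^o*n≡m*n^[1+o] m n o = trans (*-assoc m (n ^ o) n) (cong (m *_) (*-comm (n ^ o) n))

n∣m*n^o : ∀ m n o → 1 ≤ o → n ∣ m * n ^ o
n∣m*n^o m n (suc o) _ = divides (m * n ^ o) (sym (m*n^o*n≡m*n^[1+o] m n o))

∣∧∣∧<⇒+≤ : ∀ {d a b} → d ∣ a → d ∣ b → a < b → a + d ≤ b
∣∧∣∧<⇒+≤ {d} (divides u refl) (divides w refl) u*d<w*d =
  subst (_≤ w * d) (+-comm d (u * d)) (*-monoˡ-≤ d (*-cancelʳ-< d u w u*d<w*d))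

∣c*j+m*t∧coprime⇒∣c : ∀ {m c j t} → Coprime j m → m ∣ c * j + m * t → m ∣ c
∣c*j+m*t∧coprime⇒∣c {m} {c} {j} {t} j⊥m m∣c*j+m*t =
  coprime-divisor (Coprimality.sym j⊥m) (subst (m ∣_) (*-comm c j) m∣c*j)
  where
  m∣c*j : m ∣ c * j
  m∣c*j = ∣m+n∣m⇒∣n (subst (m ∣_) (+-comm (c * j) (m * t)) m∣c*j+m*t) (m∣m*n t)

∈⇒≤last : ∀ {xs y a} → Nondecreasing xs → y ∈ xs → last xs ≡ just a → y ≤ a
∈⇒≤last [-]         (here refl)  refl   = ≤-refl
∈⇒≤last (y≤z ∷ zs↑) (here refl)  last≡a = ≤-trans y≤z (∈⇒≤last zs↑ (here refl) last≡a)
∈⇒≤last (_ ∷ zs↑)   (there y∈zs) last≡a = ∈⇒≤last zs↑ y∈zs last≡a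

occ-here : ∀ x xs → occ x (x ∷ xs) ≡ suc (occ x xs)
occ-here x xs = cong length (filter-accept (_≟ x) {x} {xs} refl)

occ-there : ∀ {x y} xs → y ≢ x → occ x (y ∷ xs) ≡ occ x xs
occ-there {x} {y} xs y≢x = cong length (filter-reject (_≟ x) {y} {xs} y≢x)

∈⇒occ>0 : ∀ {x xs} → x ∈ xs → 0 < occ x xs
∈⇒occ>0 {x} x∈xs = ∈-length (∈-filter⁺ (_≟ x) x∈xs refl)

module PAdic {p : ℕ} (p-prime : Prime p) where

  instance
    p-nonZero : NonZero p
    p-nonZero = prime⇒nonZero p-prime

    p-nonTrivial : NonTrivial p
    p-nonTrivial = prime⇒nonTrivial p-prime

  data _HasValuation_ (y s : ℕ) : Set where
    factor : ∀ r → Coprime r p → y ≡ r * p ^ s → y HasValuation s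

  coprime⇒∤ : ∀ {r} → Coprime r p → p ∤ r
  coprime⇒∤ r⊥p p∣r = nonTrivial⇒≢1 (r⊥p (p∣r , ∣-refl))

  ∤⇒coprime : ∀ {r} → p ∤ r → Coprime r p
  ∤⇒coprime p∤r (d∣r , d∣p) with prime⇒irreducible p-prime d∣p
  ... | inj₁ d≡1    = d≡1
  ... | inj₂ refl   = contradiction d∣r p∤r

  *-coprime : ∀ {a b} → Coprime a p → Coprime b p → Coprime (a * b) p
  *-coprime {a} {b} a⊥p b⊥p =
    ∤⇒coprime ([ coprime⇒∤ a⊥p , coprime⇒∤ b⊥p ] ∘ euclidsLemma a b p-prime)

  valuation-nonZero : ∀ {y s} → y HasValuation s → NonZero y
  valuation-nonZero {s = s} (factor r r⊥p refl) =
    m*n≢0 r (p ^ s) {{≢-nonZero λ { refl → ¬0-coprimeTo-2+ r⊥p }}} {{m^n≢0 p s}}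

  valuation-exists : ∀ y → y ≢ 0 → ∃ (y HasValuation_)
  valuation-exists = <-rec _ step
    where
    step : ∀ y → (∀ {x} → x < y → x ≢ 0 → ∃ (x HasValuation_)) → y ≢ 0 → ∃ (y HasValuation_)
    step y rec y≢0 with p ∣? y
    ... | no p∤y = 0 , factor y (∤⇒coprime p∤y) (sym (*-identityʳ y))
    ... | yes (divides q refl) with rec q<q*p q≢0
      where
      q≢0 : q ≢ 0
      q≢0 refl = y≢0 refl
      q<q*p : q < q * p
      q<q*p = m<m*n q p {{≢-nonZero q≢0}} (nonTrivial⇒n>1 p)
    ...   | s , factor r r⊥p refl = suc s , factor r r⊥p (m*n^o*n≡m*n^[1+o] r p s)

  valuation-unique : ∀ {r r′} s s′ → Coprime r p → Coprime r′ p →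
                     r * p ^ s ≡ r′ * p ^ s′ → s ≡ s′
  valuation-unique zero    zero     _   _    _ = refl
  valuation-unique {r} {r′} zero (suc s′) r⊥p _ eq =
    contradiction (subst (p ∣_) (trans (sym eq) (*-identityʳ r)) (n∣m*n^o r′ p (suc s′) z<s))
                  (coprime⇒∤ r⊥p)
  valuation-unique (suc s) zero     r⊥p r′⊥p eq =
    sym (valuation-unique zero (suc s) r′⊥p r⊥p (sym eq))
  valuation-unique {r} {r′} (suc s) (suc s′) r⊥p r′⊥p eq =
    cong suc (valuation-unique s s′ r⊥p r′⊥p (*-cancelʳ-≡ (r * p ^ s) (r′ * p ^ s′) p (begin
      r * p ^ s * p     ≡⟨ m*n^o*n≡m*n^[1+o] r p s ⟩
      r * p ^ suc s     ≡⟨ eq ⟩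
      r′ * p ^ suc s′   ≡⟨ sym (m*n^o*n≡m*n^[1+o] r′ p s′) ⟩
      r′ * p ^ s′ * p   ∎)))

  valuation-functional : ∀ {y s s′} → y HasValuation s → y HasValuation s′ → s ≡ s′
  valuation-functional (factor _ r⊥p refl) (factor _ r′⊥p eq) = valuation-unique _ _ r⊥p r′⊥p eq

  valuation-1 : 1 HasValuation 0
  valuation-1 = factor 1 (Coprimality.1-coprimeTo p) refl

  valuation-* : ∀ {a b s t} → a HasValuation s → b HasValuation t → (a * b) HasValuation (s + t)
  valuation-* {s = s} {t} (factor r r⊥p refl) (factor r′ r′⊥p refl) =
    factor (r * r′) (*-coprime r⊥p r′⊥p) (begin
    r * p ^ s * (r′ * p ^ t)   ≡⟨ interchange *-commutativeSemigroup r (p ^ s) r′ (p ^ t) ⟩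
    r * r′ * (p ^ s * p ^ t)   ≡⟨ cong (r * r′ *_) (sym (^-distribˡ-+-* p s t)) ⟩
    r * r′ * p ^ (s + t)       ∎)

  valuation-^ : ∀ n {y s} → y HasValuation s → (y ^ n) HasValuation (n * s)
  valuation-^ zero    _   = valuation-1
  valuation-^ (suc n) y/s = valuation-* y/s (valuation-^ n y/s)

  valuation-^-divisible : ∀ {R s} m → .{{NonZero m}} → (R ^ m) HasValuation s → m ∣ s
  valuation-^-divisible {zero} (suc m) R^m/s =
    contradiction refl (≢-nonZero⁻¹ 0 {{valuation-nonZero R^m/s}})
  valuation-^-divisible {suc R} m R^m/s with valuation-exists (suc R) (λ ())
  ... | u , R/u = divides u (trans (valuation-functional R^m/s (valuation-^ m R/u)) (*-comm m u))

  OtherNonMultipleValuation : ℕ → ℕ → List ℕ → Set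
  OtherNonMultipleValuation m K xs =
    ∃₂ λ r s → r * p ^ s ∈ xs × r * p ^ s ≢ K × Coprime r p × ¬ (m ∣ s)

  module _ (m : ℕ) {K j : ℕ} (K/j : K HasValuation j) where

    other-or-valuation : ∀ xs → 0 ∉ xs →
      OtherNonMultipleValuation m K xs ⊎ ∃ λ t → product xs HasValuation (occ K xs * j + m * t)
    other-or-valuation [] _ = inj₂ (0 , subst (1 HasValuation_) (sym (*-zeroʳ m)) valuation-1)
    other-or-valuation (x ∷ xs) 0∉x∷xs with other-or-valuation xs (0∉x∷xs ∘ there)
    ... | inj₁ (r , s , y∈xs , y≢K , r⊥p , m∤s) = inj₁ (r , s , there y∈xs , y≢K , r⊥p , m∤s)
    ... | inj₂ (t , xs/v) with x ≟ K
    ...   | yes refl = inj₂ (t , subst (product (K ∷ xs) HasValuation_) eq (valuation-* K/j xs/v))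
      where
      eq : j + (occ K xs * j + m * t) ≡ occ K (K ∷ xs) * j + m * t
      eq = trans (sym (+-assoc j (occ K xs * j) (m * t)))
                 (cong (λ c → c * j + m * t) (sym (occ-here K xs)))
    ...   | no x≢K with valuation-exists x (0∉x∷xs ∘ here ∘ sym)
    ...     | s , factor r r⊥p x≡r*p^s with m ∣? s
    ...       | no m∤s  = inj₁ (r , s , here (sym x≡r*p^s) , x≢K ∘ trans x≡r*p^s , r⊥p , m∤s)
    ...       | yes (divides q refl) =
                inj₂ (q + t , subst (product (x ∷ xs) HasValuation_) eq
                                    (valuation-* {s = q * m} (factor r r⊥p x≡r*p^s) xs/v))
      where
      c = occ K xs
      eq : q * m + (c * j + m * t) ≡ occ K (x ∷ xs) * j + m * (q + t)
      eq = begin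
        q * m + (c * j + m * t)   ≡⟨ x∙yz≈y∙xz +-commutativeSemigroup (q * m) (c * j) (m * t) ⟩
        c * j + (q * m + m * t)   ≡⟨ cong (λ e → c * j + (e + m * t)) (*-comm q m) ⟩
        c * j + (m * q + m * t)   ≡⟨ cong (c * j +_) (sym (*-distribˡ-+ m q t)) ⟩
        c * j + m * (q + t)       ≡⟨ cong (λ c′ → c′ * j + m * (q + t)) (sym (occ-there xs x≢K)) ⟩
        occ K (x ∷ xs) * j + m * (q + t) ∎

    other-non-multiple-valuation : ∀ {xs R} → .{{NonZero m}} → product xs ≡ R ^ m → occ K xs < m →
      K ∈ xs → 0 ∉ xs → Coprime j m → OtherNonMultipleValuation m K xs
    other-non-multiple-valuation {xs} ∏≡R^m occ<m K∈xs 0∉xs j⊥m with other-or-valuation xs 0∉xs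
    ... | inj₁ other = other
    ... | inj₂ (t , xs/v) =
      contradiction (∣c*j+m*t∧coprime⇒∣c j⊥m m∣v) (>⇒∤ {{>-nonZero (∈⇒occ>0 K∈xs)}} occ<m)
      where
      m∣v : m ∣ occ K xs * j + m * t
      m∣v = valuation-^-divisible m (subst (_HasValuation (occ K xs * j + m * t)) ∏≡R^m xs/v)

lemma4p1 : (m p : ℕ) → 2 ≤ m → Prime p → (xs : List ℕ) → IsMProductSeq m xs →
    (k j : ℕ) → Coprime k p → 1 ≤ j → k * p ^ j ∈ xs →
    (∀ y → y ∈ xs → p ∣ y → k * p ^ j ≤ y) →
    Coprime j m →
    (∃₂ λ r s → r * p ^ s ∈ xs × r * p ^ s ≢ k * p ^ j × Coprime r p × ¬ (m ∣ s))
    × (∀ a → last xs ≡ just a → k * p ^ j + p ≤ a)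
lemma4p1 m p 2≤m p-prime xs (xs↑ , (R , ∏≡R^m) , occ<m) k j k⊥p 1≤j K∈xs K-least j⊥m =
  other , K+p≤last
  where
  open PAdic p-prime
  K = k * p ^ j

  K/j : K HasValuation j
  K/j = factor k k⊥p refl

  0∉xs : 0 ∉ xs
  0∉xs 0∈xs = ≢-nonZero⁻¹ K {{valuation-nonZero K/j}} (n≤0⇒n≡0 (K-least 0 0∈xs (p ∣0)))

  other : OtherNonMultipleValuation m K xs
  other = other-non-multiple-valuation m K/j {{>-nonZero (<-trans z<s 2≤m)}}
            ∏≡R^m (occ<m K) K∈xs 0∉xs j⊥m

  K+p≤last : ∀ a → last xs ≡ just a → K + p ≤ a
  K+p≤last a last≡a with other
  ... | r , s , y∈xs , y≢K , _ , m∤s = ≤-trans K+p≤y (∈⇒≤last xs↑ y∈xs last≡a)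
    where
    p∣y : p ∣ r * p ^ s
    p∣y = n∣m*n^o r p s (n≢0⇒n>0 λ { refl → m∤s (m ∣0) })
    K+p≤y : K + p ≤ r * p ^ s
    K+p≤y = ∣∧∣∧<⇒+≤ (n∣m*n^o k p j 1≤j) p∣y (≤∧≢⇒< (K-least _ y∈xs p∣y) (y≢K ∘ sym))
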